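{- For every integer $m\ge 0$ and all integers $n,k$ with $0\le n,k<3\cdot 2^m$, $$\binom{n+3\cdot 2^m}{k}_F\equiv \binom{n}{k}_F \pmod 2.$$
   Context: The Fibonacci numbers are defined by $F_0=0$, $F_1=1$, $F_n=F_{n-1}+F_{n-2}$ for $n\ge 2$. The Fibotorial is $n!_F=F_1F_2\cdots F_n$ (with $0!_F=1$), and the Fibonomial coefficient is $\binom{n}{k}_F=\frac{n!_F}{k!_F\,(n-k)!_F}$ for $0\le k\le n$, with the convention $\binom{n}{k}_F=0$ for $k<0$ or $k>n$. -}

module Defs where

open import Data.Nat using (ℕ; zero; suc; _+_; _*_; _∸_; _≤?_; _/_; NonZero)
open import Data.Nat.Properties using (m*n≢0)
open import Relation.Nullary using (yes; no)

fib : ℕ → ℕ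
fib zero = 0
fib (suc zero) = 1
fib (suc (suc n)) = fib (suc n) + fib n

fib-suc-nonZero : ∀ n → NonZero (fib (suc n))
fib-suc-nonZero zero = _
fib-suc-nonZero (suc zero) = _
fib-suc-nonZero (suc (suc n)) with fib (suc (suc n)) | fib-suc-nonZero (suc n)
... | suc a | _ = _

_!F : ℕ → ℕ
zero !F = 1
suc n !F = fib (suc n) * (n !F)

fibotorial-nonZero : ∀ n → NonZero (n !F)
fibotorial-nonZero zero = _
fibotorial-nonZero (suc n) =
  m*n≢0 (fib (suc n)) (n !F) {{fib-suc-nonZero n}} {{fibotorial-nonZero n}}

-- Fibonomial coefficient: n !F / (k !F * (n-k) !F) for k ≤ n, and 0 for k > n
-- (the division is exact, a known fact; here it is natural-number division)
fibonomial : ℕ → ℕ → ℕ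
fibonomial n k with k ≤? n
... | yes _ = _/_ (n !F) (k !F * ((n ∸ k) !F))
                {{m*n≢0 (k !F) ((n ∸ k) !F) {{fibotorial-nonZero k}} {{fibotorial-nonZero (n ∸ k)}}}}
... | no _ = 0

-- Reduce modulo 2. Since F_n is odd exactly when 3 ∤ n, the Fibonomial
-- triangle mod 2 factorises like Lucas' theorem in base 3: writing
-- j = r + 3a and k = s + 3b with digits r, s < 3,
--   [j+k choose k]_F ≡ [r+s choose s]_F · C(a+b, b)   (mod 2).
-- By Lucas' theorem in base 2, C(a+b, b) with b < 2^m is 2^m-periodic in a
-- and vanishes when a, b < 2^m ≤ a + b. Through the factorisation, the rows of
-- the Fibonomial triangle mod 2 are 3·2^m-periodic for k < 3·2^m, and
-- [n+3·2^m choose k]_F is even when n < k < 3·2^m, matching [n choose k]_F = 0.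
module Submission where

open import Defs
open import Data.Nat
  using (ℕ; zero; suc; _+_; _*_; _∸_; _^_; _<_; _≤_; _%_; _/_; _<ᵇ_; _≤ᵇ_; _≤?_; NonZero; s≤s; s≤s⁻¹; parity)
open import Data.Nat.Properties
open import Data.Nat.DivMod using (m≡m%n+[m/n]*n; m%n<n; m*n/n≡m; m<n*o⇒m/o<n)
open import Data.Nat.Tactic.RingSolver using (solve-∀)
open import Data.Parity.Base using (Parity; 0ℙ; 1ℙ)
  renaming (_+_ to infixl 6 _⊕_; _*_ to infixl 7 _⊗_)
import Data.Parity.Properties as ℙ
open import Data.Bool.Base using (T)
open import Data.Empty using (⊥-elim)
open import Relation.Nullary using (Dec; yes; no)
open import Relation.Binary.PropositionalEquality

fib-suc-+ : ∀ a b → fib (suc (a + b)) ≡ fib (suc a) * fib (suc b) + fib a * fib b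
fib-suc-+ zero b = sym (trans (+-identityʳ _) (+-identityʳ _))
fib-suc-+ (suc zero) b = sym (cong₂ _+_ (*-identityˡ (fib (suc b))) (*-identityˡ (fib b)))
fib-suc-+ (suc (suc a)) b =
  trans (cong₂ _+_ (fib-suc-+ (suc a) b) (fib-suc-+ a b))
        (regroup (fib (suc (suc a))) (fib (suc a)) (fib a) (fib (suc b)) (fib b))
  where
  regroup : ∀ p q r x y → (p * x + q * y) + (q * x + r * y) ≡ (p + q) * x + (q + r) * y
  regroup = solve-∀

-- fibPascal j k is [j+k choose k]_F; the recurrence comes from
-- F_{j+k+2} = F_{j+2} F_{k+1} + F_{j+1} F_k.
fibPascal : ℕ → ℕ → ℕ
fibPascal j zero = 1
fibPascal zero (suc k) = 1
fibPascal (suc j) (suc k) = fib (suc (suc j)) * fibPascal (suc j) k + fib k * fibPascal j (suc k)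

fibPascal-*-!F : ∀ j k → fibPascal j k * (k !F * j !F) ≡ (j + k) !F
fibPascal-*-!F j zero = trans (+-identityʳ _) (trans (+-identityʳ _) (cong _!F (sym (+-identityʳ j))))
fibPascal-*-!F zero (suc k) = trans (+-identityʳ _) (*-identityʳ _)
fibPascal-*-!F (suc j) (suc k) = begin
  (p * A + Fk * B) * ((Fk₁ * k !F) * (Fj₁ * j !F))
    ≡⟨ regroup p A Fk B Fk₁ (k !F) Fj₁ (j !F) ⟩
  p * Fk₁ * (A * (k !F * (Fj₁ * j !F))) + Fk * Fj₁ * (B * ((Fk₁ * k !F) * j !F))
    ≡⟨ cong₂ (λ u v → p * Fk₁ * u + Fk * Fj₁ * v)
             (fibPascal-*-!F (suc j) k)
             (trans (fibPascal-*-!F j (suc k)) (cong _!F (+-suc j k))) ⟩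
  p * Fk₁ * X + Fk * Fj₁ * X
    ≡⟨ *-distribʳ-+ X (p * Fk₁) (Fk * Fj₁) ⟨
  (p * Fk₁ + Fk * Fj₁) * X
    ≡⟨ cong (λ u → (p * Fk₁ + u) * X) (*-comm Fk Fj₁) ⟩
  (p * Fk₁ + Fj₁ * Fk) * X
    ≡⟨ cong (_* X) (fib-suc-+ (suc j) k) ⟨
  suc (suc j + k) !F
    ≡⟨ cong (λ i → suc i !F) (+-suc j k) ⟨
  (suc j + suc k) !F ∎
  where
  open ≡-Reasoning
  p = fib (suc (suc j))
  A = fibPascal (suc j) k
  Fk = fib k
  B = fibPascal j (suc k)
  Fk₁ = fib (suc k)
  Fj₁ = fib (suc j)
  X = (suc j + k) !F
  regroup : ∀ p a q b x y z w →
    (p * a + q * b) * ((x * y) * (z * w)) ≡ p * x * (a * (y * (z * w))) + q * z * (b * ((x * y) * w))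
  regroup = solve-∀

fibonomial≡fibPascal : ∀ {n k} → k ≤ n → fibonomial n k ≡ fibPascal (n ∸ k) k
fibonomial≡fibPascal {n} {k} k≤n with k ≤? n
... | no k≰n = ⊥-elim (k≰n k≤n)
... | yes _ = trans (cong (λ x → _/_ x D {{D≢0}}) n!F≡) (m*n/n≡m (fibPascal (n ∸ k) k) D {{D≢0}})
  where
  D = k !F * (n ∸ k) !F
  D≢0 : NonZero D
  D≢0 = m*n≢0 (k !F) ((n ∸ k) !F) {{fibotorial-nonZero k}} {{fibotorial-nonZero (n ∸ k)}}
  n!F≡ : n !F ≡ fibPascal (n ∸ k) k * D
  n!F≡ = sym (trans (fibPascal-*-!F (n ∸ k) k) (cong _!F (m∸n+n≡m k≤n)))

fibonomial-vanishes : ∀ {n k} → n < k → fibonomial n k ≡ 0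
fibonomial-vanishes {n} {k} n<k with k ≤? n
... | yes k≤n = ⊥-elim (<⇒≱ n<k k≤n)
... | no _ = refl

3∤ : ℕ → Parity
3∤ zero = 0ℙ
3∤ (suc zero) = 1ℙ
3∤ (suc (suc zero)) = 1ℙ
3∤ (suc (suc (suc n))) = 3∤ n

3∤-+*3 : ∀ r a → 3∤ (r + a * 3) ≡ 3∤ r
3∤-+*3 (suc (suc (suc r))) a = 3∤-+*3 r a
3∤-+*3 r zero = cong 3∤ (+-identityʳ r)
3∤-+*3 zero (suc a) = 3∤-+*3 zero a
3∤-+*3 (suc zero) (suc a) = 3∤-+*3 (suc zero) a
3∤-+*3 (suc (suc zero)) (suc a) = 3∤-+*3 (suc (suc zero)) a

parity-fib : ∀ n → parity (fib n) ≡ 3∤ n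
parity-fib zero = refl
parity-fib (suc zero) = refl
parity-fib (suc (suc zero)) = refl
parity-fib (suc (suc (suc n))) = begin
  parity (fib (2 + n) + fib (suc n))                           ≡⟨ ℙ.+-homo-+ (fib (2 + n)) (fib (suc n)) ⟩
  parity (fib (suc n) + fib n) ⊕ parity (fib (suc n))          ≡⟨ cong (_⊕ parity (fib (suc n))) (ℙ.+-homo-+ (fib (suc n)) (fib n)) ⟩
  parity (fib (suc n)) ⊕ parity (fib n) ⊕ parity (fib (suc n)) ≡⟨ x⊕y⊕x≡y (parity (fib (suc n))) (parity (fib n)) ⟩
  parity (fib n)                                               ≡⟨ parity-fib n ⟩
  3∤ n ∎
  where
  open ≡-Reasoning
  x⊕y⊕x≡y : ∀ x y → x ⊕ y ⊕ x ≡ y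
  x⊕y⊕x≡y 0ℙ y = ℙ.+-identityʳ y
  x⊕y⊕x≡y 1ℙ 0ℙ = refl
  x⊕y⊕x≡y 1ℙ 1ℙ = refl

fibPascal₂ : ℕ → ℕ → Parity
fibPascal₂ j zero = 1ℙ
fibPascal₂ zero (suc k) = 1ℙ
fibPascal₂ (suc j) (suc k) = 3∤ (suc (suc j)) ⊗ fibPascal₂ (suc j) k ⊕ 3∤ k ⊗ fibPascal₂ j (suc k)

parity-fibPascal : ∀ j k → parity (fibPascal j k) ≡ fibPascal₂ j k
parity-fibPascal j zero = refl
parity-fibPascal zero (suc k) = refl
parity-fibPascal (suc j) (suc k) =
  trans (ℙ.+-homo-+ (fib (suc (suc j)) * fibPascal (suc j) k) (fib k * fibPascal j (suc k)))
        (cong₂ _⊕_ (parity-term (suc (suc j)) (suc j) k) (parity-term k j (suc k)))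
  where
  parity-term : ∀ i j k → parity (fib i * fibPascal j k) ≡ 3∤ i ⊗ fibPascal₂ j k
  parity-term i j k = trans (ℙ.*-homo-* (fib i) (fibPascal j k)) (cong₂ _⊗_ (parity-fib i) (parity-fibPascal j k))

parity-fibonomial : ∀ {n k} → k ≤ n → parity (fibonomial n k) ≡ fibPascal₂ (n ∸ k) k
parity-fibonomial {n} {k} k≤n = trans (cong parity (fibonomial≡fibPascal k≤n)) (parity-fibPascal (n ∸ k) k)

parity≡⇒%2≡ : ∀ m n → parity m ≡ parity n → m % 2 ≡ n % 2
parity≡⇒%2≡ (suc (suc m)) n eq = parity≡⇒%2≡ m n eq
parity≡⇒%2≡ m (suc (suc n)) eq = parity≡⇒%2≡ m n eq
parity≡⇒%2≡ zero zero _ = refl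
parity≡⇒%2≡ (suc zero) (suc zero) _ = refl
parity≡⇒%2≡ zero (suc zero) ()
parity≡⇒%2≡ (suc zero) zero ()

-- pascal₂ j k is the parity of the binomial coefficient C(j+k, k).
pascal₂ : ℕ → ℕ → Parity
pascal₂ j zero = 1ℙ
pascal₂ zero (suc k) = 1ℙ
pascal₂ (suc j) (suc k) = pascal₂ (suc j) k ⊕ pascal₂ j (suc k)

-- Digits are written r + a * 2, not 2 * a, so that a successor quotient unfolds
-- by computation; their bound T (r <ᵇ 2) is solved automatically for literal r.
pascal₂-lucas : ∀ a b r s {_ : T (r <ᵇ 2)} {_ : T (s <ᵇ 2)} →
  pascal₂ (r + a * 2) (s + b * 2) ≡ pascal₂ r s ⊗ pascal₂ a b
pascal₂-lucas a zero 0 0 = refl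
pascal₂-lucas a zero 1 0 = refl
pascal₂-lucas zero (suc b) 0 0 = refl
pascal₂-lucas zero zero 0 1 = refl
pascal₂-lucas zero (suc b) 0 1 = refl
pascal₂-lucas (suc a) (suc b) 0 0 = cong₂ _⊕_ (pascal₂-lucas (suc a) b 0 1) (pascal₂-lucas a (suc b) 1 0)
pascal₂-lucas (suc a) b 0 1 =
  trans (cong₂ _⊕_ (pascal₂-lucas (suc a) b 0 0) (pascal₂-lucas a b 1 1)) (ℙ.+-identityʳ _)
pascal₂-lucas a (suc b) 1 0 = cong₂ _⊕_ (pascal₂-lucas a b 1 1) (pascal₂-lucas a (suc b) 0 0)
pascal₂-lucas a b 1 1 =
  trans (cong₂ _⊕_ (pascal₂-lucas a b 1 0) (pascal₂-lucas a b 0 1)) (ℙ.p+p≡0ℙ (pascal₂ a b))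
pascal₂-lucas a b (suc (suc r)) s {()}
pascal₂-lucas a b r (suc (suc s)) {_} {()}

pascal₂-carry : ∀ r s {_ : T (r <ᵇ 2)} {_ : T (s <ᵇ 2)} → T (2 ≤ᵇ r + s) → pascal₂ r s ≡ 0ℙ
pascal₂-carry 1 1 _ = refl
pascal₂-carry 0 0 ()
pascal₂-carry 0 1 ()
pascal₂-carry 1 0 ()
pascal₂-carry (suc (suc r)) s {()}
pascal₂-carry r (suc (suc s)) {_} {()}

cong-⊗⊕⊗ : ∀ {p p′ x x′ q q′ y y′} → p ≡ p′ → x ≡ x′ → q ≡ q′ → y ≡ y′ → p ⊗ x ⊕ q ⊗ y ≡ p′ ⊗ x′ ⊕ q′ ⊗ y′
cong-⊗⊕⊗ refl refl refl refl = refl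

fibPascal₂-lucas : ∀ a b r s {_ : T (r <ᵇ 3)} {_ : T (s <ᵇ 3)} →
  fibPascal₂ (r + a * 3) (s + b * 3) ≡ fibPascal₂ r s ⊗ pascal₂ a b
fibPascal₂-lucas a zero 0 0 = refl
fibPascal₂-lucas a zero 1 0 = refl
fibPascal₂-lucas a zero 2 0 = refl
fibPascal₂-lucas zero (suc b) 0 0 = refl
fibPascal₂-lucas zero zero 0 1 = refl
fibPascal₂-lucas zero (suc b) 0 1 = refl
fibPascal₂-lucas zero zero 0 2 = refl
fibPascal₂-lucas zero (suc b) 0 2 = refl
fibPascal₂-lucas (suc a) (suc b) 0 0 =
  cong-⊗⊕⊗ (3∤-+*3 1 a) (fibPascal₂-lucas (suc a) b 0 2) (3∤-+*3 2 b) (fibPascal₂-lucas a (suc b) 2 0)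
fibPascal₂-lucas (suc a) b 0 1 = trans
  (cong-⊗⊕⊗ (3∤-+*3 1 a) (fibPascal₂-lucas (suc a) b 0 0) (3∤-+*3 0 b) (fibPascal₂-lucas a b 2 1))
  (ℙ.+-identityʳ _)
fibPascal₂-lucas (suc a) b 0 2 = trans
  (cong-⊗⊕⊗ (3∤-+*3 1 a) (fibPascal₂-lucas (suc a) b 0 1) (3∤-+*3 1 b) (fibPascal₂-lucas a b 2 2))
  (ℙ.+-identityʳ _)
fibPascal₂-lucas a (suc b) 1 0 =
  cong-⊗⊕⊗ (3∤-+*3 2 a) (fibPascal₂-lucas a b 1 2) (3∤-+*3 2 b) (fibPascal₂-lucas a (suc b) 0 0)
fibPascal₂-lucas a b 1 1 = trans
  (cong-⊗⊕⊗ (3∤-+*3 2 a) (fibPascal₂-lucas a b 1 0) (3∤-+*3 0 b) (fibPascal₂-lucas a b 0 1))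
  (ℙ.+-identityʳ _)
fibPascal₂-lucas a b 1 2 = trans
  (cong-⊗⊕⊗ (3∤-+*3 2 a) (fibPascal₂-lucas a b 1 1) (3∤-+*3 1 b) (fibPascal₂-lucas a b 0 2))
  (ℙ.p+p≡0ℙ (pascal₂ a b))
fibPascal₂-lucas a (suc b) 2 0 =
  cong-⊗⊕⊗ (3∤-+*3 0 a) (fibPascal₂-lucas a b 2 2) (3∤-+*3 2 b) (fibPascal₂-lucas a (suc b) 1 0)
fibPascal₂-lucas a b 2 1 =
  cong-⊗⊕⊗ (3∤-+*3 0 a) (fibPascal₂-lucas a b 2 0) (3∤-+*3 0 b) (fibPascal₂-lucas a b 1 1)
fibPascal₂-lucas a b 2 2 =
  cong-⊗⊕⊗ (3∤-+*3 0 a) (fibPascal₂-lucas a b 2 1) (3∤-+*3 1 b) (fibPascal₂-lucas a b 1 2)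
fibPascal₂-lucas a b (suc (suc (suc r))) s {()}
fibPascal₂-lucas a b r (suc (suc (suc s))) {_} {()}

fibPascal₂-carry : ∀ r s {_ : T (r <ᵇ 3)} {_ : T (s <ᵇ 3)} → T (3 ≤ᵇ r + s) → fibPascal₂ r s ≡ 0ℙ
fibPascal₂-carry 1 2 _ = refl
fibPascal₂-carry 2 1 _ = refl
fibPascal₂-carry 2 2 _ = refl
fibPascal₂-carry 0 0 ()
fibPascal₂-carry 0 1 ()
fibPascal₂-carry 0 2 ()
fibPascal₂-carry 1 0 ()
fibPascal₂-carry 1 1 ()
fibPascal₂-carry 2 0 ()
fibPascal₂-carry (suc (suc (suc r))) s {()}
fibPascal₂-carry r (suc (suc (suc s))) {_} {()}

-- A Lucas-type factorisation over base-q digits carries the periodicity of the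
-- rows of g, and its vanishing when a + b carries past N, over to f at scale q N.
module LucasTransfer
  (q : ℕ) .{{_ : NonZero q}} (f g : ℕ → ℕ → Parity)
  (lucas : ∀ a b r s {_ : T (r <ᵇ q)} {_ : T (s <ᵇ q)} → f (r + a * q) (s + b * q) ≡ f r s ⊗ g a b)
  where

  private
    lucas-digits : ∀ a b j k → f (j % q + a * q) (k % q + b * q) ≡ f (j % q) (k % q) ⊗ g a b
    lucas-digits a b j k = lucas a b (j % q) (k % q) {<⇒<ᵇ (m%n<n j q)} {<⇒<ᵇ (m%n<n k q)}

    f≡digits : ∀ j k → f j k ≡ f (j % q + (j / q) * q) (k % q + (k / q) * q)
    f≡digits j k = cong₂ f (m≡m%n+[m/n]*n j q) (m≡m%n+[m/n]*n k q)

    quotient< : ∀ {j N} → j < q * N → j / q < N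
    quotient< {j} {N} j<qN = m<n*o⇒m/o<n (subst (j <_) (*-comm q N) j<qN)

  periodic : ∀ {N} → (∀ a b → b < N → g (a + N) b ≡ g a b) →
    ∀ j k → k < q * N → f (j + q * N) k ≡ f j k
  periodic {N} g-periodic j k k<qN = begin
    f (j + q * N) k                 ≡⟨ cong₂ f shift (m≡m%n+[m/n]*n k q) ⟩
    f (r + (a + N) * q) (s + b * q) ≡⟨ lucas-digits (a + N) b j k ⟩
    f r s ⊗ g (a + N) b             ≡⟨ cong (f r s ⊗_) (g-periodic a b (quotient< k<qN)) ⟩
    f r s ⊗ g a b                   ≡⟨ lucas-digits a b j k ⟨
    f (r + a * q) (s + b * q)       ≡⟨ f≡digits j k ⟨
    f j k ∎
    where
    open ≡-Reasoning
    r = j % q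
    a = j / q
    s = k % q
    b = k / q
    shift : j + q * N ≡ r + (a + N) * q
    shift = trans (cong (_+ q * N) (m≡m%n+[m/n]*n j q)) (regroup r a q N)
      where
      regroup : ∀ r a q N → r + a * q + q * N ≡ r + (a + N) * q
      regroup = solve-∀

  vanishing : (∀ r s {_ : T (r <ᵇ q)} {_ : T (s <ᵇ q)} → T (q ≤ᵇ r + s) → f r s ≡ 0ℙ) →
    ∀ {N} → (∀ a b → a < N → b < N → N ≤ a + b → g a b ≡ 0ℙ) →
    ∀ j k → j < q * N → k < q * N → q * N ≤ j + k → f j k ≡ 0ℙ
  vanishing carry {N} g-vanishing j k j<qN k<qN qN≤j+k =
    trans (trans (f≡digits j k) (lucas-digits a b j k)) (by-carry (q ≤? r + s))
    where
    r = j % q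
    a = j / q
    s = k % q
    b = k / q
    N≤a+b : r + s < q → N ≤ a + b
    N≤a+b r+s<q = s≤s⁻¹ (*-cancelʳ-< q N (suc (a + b)) (begin-strict
      N * q                   ≡⟨ *-comm N q ⟩
      q * N                   ≤⟨ qN≤j+k ⟩
      j + k                   ≡⟨ cong₂ _+_ (m≡m%n+[m/n]*n j q) (m≡m%n+[m/n]*n k q) ⟩
      r + a * q + (s + b * q) ≡⟨ regroup r a s b q ⟩
      r + s + (a + b) * q     <⟨ +-monoˡ-< ((a + b) * q) r+s<q ⟩
      suc (a + b) * q         ∎))
      where
      open ≤-Reasoning
      regroup : ∀ r a s b q → r + a * q + (s + b * q) ≡ r + s + (a + b) * q
      regroup = solve-∀
    by-carry : Dec (q ≤ r + s) → f r s ⊗ g a b ≡ 0ℙ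
    by-carry (yes q≤r+s) = cong (_⊗ g a b)
      (carry r s {<⇒<ᵇ (m%n<n j q)} {<⇒<ᵇ (m%n<n k q)} (≤⇒≤ᵇ q≤r+s))
    by-carry (no q≰r+s) = trans (cong (f r s ⊗_)
      (g-vanishing a b (quotient< j<qN) (quotient< k<qN) (N≤a+b (≰⇒> q≰r+s))))
      (ℙ.*-zeroʳ (f r s))

module Base2 = LucasTransfer 2 pascal₂ pascal₂ pascal₂-lucas
module Base3 = LucasTransfer 3 fibPascal₂ pascal₂ fibPascal₂-lucas

pascal₂-periodic : ∀ m a b → b < 2 ^ m → pascal₂ (a + 2 ^ m) b ≡ pascal₂ a b
pascal₂-periodic zero a zero _ = refl
pascal₂-periodic zero a (suc b) (s≤s ())
pascal₂-periodic (suc m) = Base2.periodic (pascal₂-periodic m)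

pascal₂-vanishing : ∀ m a b → a < 2 ^ m → b < 2 ^ m → 2 ^ m ≤ a + b → pascal₂ a b ≡ 0ℙ
pascal₂-vanishing zero zero zero _ _ ()
pascal₂-vanishing zero (suc a) b (s≤s ()) _ _
pascal₂-vanishing zero zero (suc b) _ (s≤s ()) _
pascal₂-vanishing (suc m) = Base2.vanishing pascal₂-carry (pascal₂-vanishing m)

theorem1p2 : ∀ (m n k : ℕ) → n < 3 * 2 ^ m → k < 3 * 2 ^ m →
    fibonomial (n + 3 * 2 ^ m) k % 2 ≡ fibonomial n k % 2
theorem1p2 m n k _ k<N =
  parity≡⇒%2≡ (fibonomial (n + N) k) (fibonomial n k) (parities (k ≤? n))
  where
  open ≡-Reasoning
  N = 3 * 2 ^ m
  k≤n+N : k ≤ n + N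
  k≤n+N = ≤-trans (<⇒≤ k<N) (m≤n+m N n)
  parities : Dec (k ≤ n) → parity (fibonomial (n + N) k) ≡ parity (fibonomial n k)
  parities (yes k≤n) = begin
    parity (fibonomial (n + N) k) ≡⟨ parity-fibonomial k≤n+N ⟩
    fibPascal₂ (n + N ∸ k) k      ≡⟨ cong (λ j → fibPascal₂ j k) (+-∸-comm N k≤n) ⟩
    fibPascal₂ (n ∸ k + N) k      ≡⟨ Base3.periodic (pascal₂-periodic m) (n ∸ k) k k<N ⟩
    fibPascal₂ (n ∸ k) k          ≡⟨ parity-fibonomial k≤n ⟨
    parity (fibonomial n k)       ∎
  parities (no k≰n) = begin
    parity (fibonomial (n + N) k) ≡⟨ parity-fibonomial k≤n+N ⟩
    fibPascal₂ (n + N ∸ k) k      ≡⟨ Base3.vanishing fibPascal₂-carry (pascal₂-vanishing m) (n + N ∸ k) k j<N k<N N≤j+k ⟩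
    0ℙ                            ≡⟨ cong parity (fibonomial-vanishes (≰⇒> k≰n)) ⟨
    parity (fibonomial n k)       ∎
    where
    j<N : n + N ∸ k < N
    j<N = subst (n + N ∸ k <_) (m+n∸m≡n n N) (∸-monoʳ-< (≰⇒> k≰n) k≤n+N)
    N≤j+k : N ≤ n + N ∸ k + k
    N≤j+k = subst (N ≤_) (sym (m∸n+n≡m k≤n+N)) (m≤n+m N n)
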